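{- The formal power series $$A(x,y,z)=\sum_{n\geq 0}\sum_{\mathscr{D}\in\mathcal{P}_n}x^ny^{v(\mathscr{D})}z^{tf(\mathscr{D})},\qquad B(x,y,z)=\sum_{n\geq 0}\sum_{\mathscr{D}\in\mathcal{IP}_n}x^ny^{v(\mathscr{D})}z^{tf(\mathscr{D})}$$ satisfy $$B(x,y,z)=(A(x,y,z)-1)(xz+x^2y-x^2yz)+1+x+x^2-x^2z,$$ $$A(x,y,z)=B(x,y,z)+y\,(B(x,y,z)-1)(A(x,y,z)-1).$$
   Context: A Dyck path of semilength $n$ is a lattice path from $(0,0)$ consisting of $n$ up steps $U=(1,1)$ and $n$ down steps $D=(1,-1)$, never going below the $x$-axis and ending on the $x$-axis. $\mathcal{P}_n$ is the set of Dyck paths of semilength $n$ ($\mathcal{P}_0$ consists of the empty path). A return is a down step ending on the $x$-axis; a Dyck path is irreducible if it has exactly one return, and $\mathcal{IP}_n$ is the set of irreducible Dyck paths of semilength $n$ for $n\geq 1$, with the convention that $\mathcal{IP}_0$ consists of the empty path (so $B$ has constant term $1$). $v(\mathscr{D})$ is the number of valleys (occurrences of consecutive steps $DU$) of $\mathscr{D}$ and $tf(\mathscr{D})$ is the number of triple falls (occurrences of consecutive steps $DDD$) of $\mathscr{D}$. -}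

module Defs where

open import Data.Nat using (ℕ; zero; suc; _∸_; _≡ᵇ_; _*_)
open import Data.Bool using (Bool; true; false; _∧_; if_then_else_)
open import Data.List using (List; []; _∷_; map; _++_; filter; length; [_])
open import Data.Integer using (ℤ; +_) renaming (_+_ to _+ℤ_; _*_ to _*ℤ_; -_ to -ℤ_)
open import Relation.Binary.PropositionalEquality using (_≡_)
open import Relation.Nullary.Decidable using (does)
open import Data.Bool using (T)
open import Data.Bool.Properties using (T?)

data Step : Set where
  U D : Step

Path : Set
Path = List Step

words : ℕ → List Path
words zero = [ [] ]
words (suc m) = map (U ∷_) (words m) ++ map (D ∷_) (words m)

walk : ℕ → Path → Bool
walk h [] = h ≡ᵇ 0
walk h (U ∷ s) = walk (suc h) s
walk zero (D ∷ s) = false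
walk (suc h) (D ∷ s) = walk h s

isDyck : Path → Bool
isDyck = walk 0

rets : ℕ → Path → ℕ
rets h [] = 0
rets h (U ∷ s) = rets (suc h) s
rets zero (D ∷ s) = rets zero s
rets (suc h) (D ∷ s) = (if h ≡ᵇ 0 then 1 else 0) Data.Nat.+ rets h s

returns : Path → ℕ
returns = rets 0

dyckPaths : ℕ → List Path
dyckPaths n = filter (λ p → T? (isDyck p)) (words (2 * n))

-- IP_n : irreducible Dyck paths (exactly one return); IP_0 = {empty path}
irrPaths : ℕ → List Path
irrPaths zero = [ [] ]
irrPaths (suc n) = filter (λ p → T? (returns p ≡ᵇ 1)) (dyckPaths (suc n))

valleys : Path → ℕ
valleys [] = 0
valleys (U ∷ s) = valleys s
valleys (D ∷ []) = 0
valleys (D ∷ U ∷ s) = suc (valleys (U ∷ s))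
valleys (D ∷ D ∷ s) = valleys (D ∷ s)

tfalls : Path → ℕ
tfalls [] = 0
tfalls (U ∷ s) = tfalls s
tfalls (D ∷ []) = 0
tfalls (D ∷ U ∷ s) = tfalls (U ∷ s)
tfalls (D ∷ D ∷ []) = 0
tfalls (D ∷ D ∷ U ∷ s) = tfalls (D ∷ U ∷ s)
tfalls (D ∷ D ∷ D ∷ s) = suc (tfalls (D ∷ D ∷ s))

-- Formal power series in x, y, z with integer coefficients:
-- F n i j = coefficient of x^n y^i z^j.

FPS : Set
FPS = ℕ → ℕ → ℕ → ℤ

Σ≤ : ℕ → (ℕ → ℤ) → ℤ
Σ≤ zero f = f 0
Σ≤ (suc n) f = Σ≤ n f +ℤ f (suc n)

_⊕_ : FPS → FPS → FPS
(f ⊕ g) n i j = f n i j +ℤ g n i j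

⊖_ : FPS → FPS
(⊖ f) n i j = -ℤ (f n i j)

_⊝_ : FPS → FPS → FPS
f ⊝ g = f ⊕ (⊖ g)

_⊛_ : FPS → FPS → FPS
(f ⊛ g) n i j =
  Σ≤ n λ a → Σ≤ i λ b → Σ≤ j λ c → f a b c *ℤ g (n ∸ a) (i ∸ b) (j ∸ c)

infixl 6 _⊕_ _⊝_
infixl 7 _⊛_

mono : ℕ → ℕ → ℕ → FPS
mono a b c n i j = if (n ≡ᵇ a) ∧ (i ≡ᵇ b) ∧ (j ≡ᵇ c) then + 1 else + 0

one X Y Z : FPS
one = mono 0 0 0
X = mono 1 0 0
Y = mono 0 1 0
Z = mono 0 0 1

_≐_ : FPS → FPS → Set
f ≐ g = ∀ n i j → f n i j ≡ g n i j

infix 4 _≐_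

gf : (ℕ → List Path) → FPS
gf S n i j = + length (filter (λ p → T? ((valleys p ≡ᵇ i) ∧ (tfalls p ≡ᵇ j))) (S n))

A B : FPS
A = gf dyckPaths
B = gf irrPaths

-- Write A⁺ = A − 1 and B⁺ = B − 1. A nonempty Dyck path is either irreducible or factors
-- uniquely at its first return as u v with u irreducible and v nonempty; the junction DU is
-- one more valley and creates no triple fall, so A⁺ = B⁺ + y B⁺ A⁺.
-- The irreducible paths of semilength n + 1 are the lifts U w D of the Dyck paths w of
-- semilength n; lifting keeps the valleys and adds a triple fall exactly when w ends in DD.
-- A nonempty w ends either in UD, and these paths have series x (y A⁺ + 1), or in DD, with
-- series S say. So A⁺ = x (y A⁺ + 1) + S and B = 1 + x + x² (y A⁺ + 1) + x z S, and
-- eliminating S gives the first equation.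
-- Coefficients are computed as integer sums over all words of a given length weighted by
-- indicators, so that the bijections above become reindexings of such sums.

module Submission where

open import Defs
open import Data.Bool using (Bool; true; false; _∧_; not; if_then_else_)
open import Data.Bool.Properties using (T?; ∧-identityʳ; ∧-zeroʳ)
open import Data.List using (List; []; _∷_; _++_; null; filter; map; length)
open import Data.List.Properties using (++-assoc)
open import Data.Nat using (ℕ; zero; suc; _+_; _*_; _∸_; _≡ᵇ_)
import Data.Nat.Properties as ℕ
open import Data.Integer using (ℤ; +_; +0) renaming (_+_ to _+ℤ_; _*_ to _*ℤ_; -_ to -ℤ_)
import Data.Integer.Properties as ℤ
open import Data.Integer.Tactic.RingSolver using (solve-∀)
open import Data.Product using (_×_; _,_)
open import Function using (_∘_)
open import Relation.Binary.PropositionalEquality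

open ≡-Reasoning

𝟙 : Bool → ℤ
𝟙 b = if b then + 1 else +0

𝟙-∧ : ∀ p q → 𝟙 (p ∧ q) ≡ 𝟙 p *ℤ 𝟙 q
𝟙-∧ true q = sym (ℤ.*-identityˡ (𝟙 q))
𝟙-∧ false q = refl

≡ᵇ-sym : ∀ m n → (m ≡ᵇ n) ≡ (n ≡ᵇ m)
≡ᵇ-sym zero zero = refl
≡ᵇ-sym zero (suc n) = refl
≡ᵇ-sym (suc m) zero = refl
≡ᵇ-sym (suc m) (suc n) = ≡ᵇ-sym m n

double : ℕ → ℕ
double zero = zero
double (suc n) = suc (suc (double n))

2*≡double : ∀ n → 2 * n ≡ double n
2*≡double zero = refl
2*≡double (suc n) = cong suc (trans (ℕ.+-suc n (n + 0)) (cong suc (2*≡double n)))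

double-∸ : ∀ n a → double n ∸ double a ≡ double (n ∸ a)
double-∸ zero zero = refl
double-∸ zero (suc a) = refl
double-∸ (suc n) zero = refl
double-∸ (suc n) (suc a) = double-∸ n a

+-interchange : ∀ a b c d → (a +ℤ b) +ℤ (c +ℤ d) ≡ (a +ℤ c) +ℤ (b +ℤ d)
+-interchange = solve-∀

Σ≤-cong : ∀ n {f g : ℕ → ℤ} → (∀ k → f k ≡ g k) → Σ≤ n f ≡ Σ≤ n g
Σ≤-cong zero e = e 0
Σ≤-cong (suc n) e = cong₂ _+ℤ_ (Σ≤-cong n e) (e (suc n))

Σ≤-zero : ∀ n → Σ≤ n (λ _ → +0) ≡ +0
Σ≤-zero zero = refl
Σ≤-zero (suc n) = cong (_+ℤ +0) (Σ≤-zero n)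

Σ≤-+ : ∀ n (f g : ℕ → ℤ) → Σ≤ n (λ k → f k +ℤ g k) ≡ Σ≤ n f +ℤ Σ≤ n g
Σ≤-+ zero f g = refl
Σ≤-+ (suc n) f g = trans (cong (_+ℤ (f (suc n) +ℤ g (suc n))) (Σ≤-+ n f g))
                         (+-interchange (Σ≤ n f) (Σ≤ n g) (f (suc n)) (g (suc n)))

Σ≤-neg : ∀ n (f : ℕ → ℤ) → Σ≤ n (λ k → -ℤ f k) ≡ -ℤ Σ≤ n f
Σ≤-neg zero f = refl
Σ≤-neg (suc n) f = trans (cong (_+ℤ -ℤ f (suc n)) (Σ≤-neg n f))
                         (sym (ℤ.neg-distrib-+ (Σ≤ n f) (f (suc n))))

Σ≤-*ˡ : ∀ n x (f : ℕ → ℤ) → Σ≤ n (λ k → x *ℤ f k) ≡ x *ℤ Σ≤ n f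
Σ≤-*ˡ zero x f = refl
Σ≤-*ˡ (suc n) x f = trans (cong (_+ℤ x *ℤ f (suc n)) (Σ≤-*ˡ n x f))
                          (sym (ℤ.*-distribˡ-+ x (Σ≤ n f) (f (suc n))))

Σ≤-*ʳ : ∀ n x (f : ℕ → ℤ) → Σ≤ n (λ k → f k *ℤ x) ≡ Σ≤ n f *ℤ x
Σ≤-*ʳ n x f = trans (Σ≤-cong n (λ k → ℤ.*-comm (f k) x)) (trans (Σ≤-*ˡ n x f) (ℤ.*-comm x _))

Σ≤-suc : ∀ n (f : ℕ → ℤ) → Σ≤ (suc n) f ≡ f 0 +ℤ Σ≤ n (f ∘ suc)
Σ≤-suc zero f = refl
Σ≤-suc (suc n) f = trans (cong (_+ℤ f (suc (suc n))) (Σ≤-suc n f)) (ℤ.+-assoc (f 0) _ _)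

Σ≤-double : ∀ n (g : ℕ → ℤ) → (∀ a → g (suc (double a)) ≡ +0) → Σ≤ (double n) g ≡ Σ≤ n (g ∘ double)
Σ≤-double zero g odd = refl
Σ≤-double (suc n) g odd = cong (_+ℤ g (double (suc n)))
  (trans (cong (Σ≤ (double n) g +ℤ_) (odd n)) (trans (ℤ.+-identityʳ _) (Σ≤-double n g odd)))

guard≤ : ℕ → ℕ → ℤ → ℤ
guard≤ zero n x = x
guard≤ (suc e) zero x = +0
guard≤ (suc e) (suc n) x = guard≤ e n x

guard≤-zero : ∀ e n → guard≤ e n +0 ≡ +0
guard≤-zero zero n = refl
guard≤-zero (suc e) zero = refl
guard≤-zero (suc e) (suc n) = guard≤-zero e n

guard≤-+ : ∀ e n x y → guard≤ e n (x +ℤ y) ≡ guard≤ e n x +ℤ guard≤ e n y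
guard≤-+ zero n x y = refl
guard≤-+ (suc e) zero x y = refl
guard≤-+ (suc e) (suc n) x y = guard≤-+ e n x y

guard≤-*ˡ : ∀ e n x y → guard≤ e n (x *ℤ y) ≡ guard≤ e n x *ℤ y
guard≤-*ˡ zero n x y = refl
guard≤-*ˡ (suc e) zero x y = refl
guard≤-*ˡ (suc e) (suc n) x y = guard≤-*ˡ e n x y

guard≤-*ʳ : ∀ e n x y → guard≤ e n (x *ℤ y) ≡ x *ℤ guard≤ e n y
guard≤-*ʳ zero n x y = refl
guard≤-*ʳ (suc e) zero x y = sym (ℤ.*-zeroʳ x)
guard≤-*ʳ (suc e) (suc n) x y = guard≤-*ʳ e n x y

guard≤-comm : ∀ a m b n x → guard≤ a m (guard≤ b n x) ≡ guard≤ b n (guard≤ a m x)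
guard≤-comm zero m b n x = refl
guard≤-comm (suc a) zero b n x = sym (guard≤-zero b n)
guard≤-comm (suc a) (suc m) b n x = guard≤-comm a m b n x

guard≤-𝟙 : ∀ e a n → guard≤ e n (𝟙 (n ∸ e ≡ᵇ a)) ≡ 𝟙 (n ≡ᵇ e + a)
guard≤-𝟙 zero a n = refl
guard≤-𝟙 (suc e) a zero = refl
guard≤-𝟙 (suc e) a (suc n) = guard≤-𝟙 e a n

Σ≤-selectˡ : ∀ e n (h : ℕ → ℤ) → Σ≤ n (λ k → 𝟙 (k ≡ᵇ e) *ℤ h k) ≡ guard≤ e n (h e)
Σ≤-selectˡ zero zero h = ℤ.*-identityˡ (h 0)
Σ≤-selectˡ (suc e) zero h = refl
Σ≤-selectˡ zero (suc n) h = trans (Σ≤-suc n _)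
  (trans (cong₂ _+ℤ_ (ℤ.*-identityˡ (h 0)) (Σ≤-zero n)) (ℤ.+-identityʳ (h 0)))
Σ≤-selectˡ (suc e) (suc n) h =
  trans (Σ≤-suc n _) (trans (ℤ.+-identityˡ _) (Σ≤-selectˡ e n (h ∘ suc)))

Σ≤-selectʳ : ∀ e n (h : ℕ → ℤ) → Σ≤ n (λ k → h k *ℤ 𝟙 (n ∸ k ≡ᵇ e)) ≡ guard≤ e n (h (n ∸ e))
Σ≤-selectʳ zero zero h = ℤ.*-identityʳ (h 0)
Σ≤-selectʳ (suc e) zero h = ℤ.*-zeroʳ (h 0)
Σ≤-selectʳ e (suc n) h =
  trans (Σ≤-suc n _) (trans (cong (h 0 *ℤ 𝟙 (suc n ≡ᵇ e) +ℤ_) (Σ≤-selectʳ e n (h ∘ suc))) (peel e n))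
  where
  peel : ∀ e n → h 0 *ℤ 𝟙 (suc n ≡ᵇ e) +ℤ guard≤ e n (h (suc (n ∸ e))) ≡ guard≤ e (suc n) (h (suc n ∸ e))
  peel zero n = trans (cong (_+ℤ h (suc n)) (ℤ.*-zeroʳ (h 0))) (ℤ.+-identityˡ _)
  peel (suc zero) zero = trans (ℤ.+-identityʳ _) (ℤ.*-identityʳ (h 0))
  peel (suc (suc e)) zero = cong (_+ℤ +0) (ℤ.*-zeroʳ (h 0))
  peel (suc e) (suc n) = peel e n

≐-refl : ∀ {f : FPS} → f ≐ f
≐-refl _ _ _ = refl

_≐-trans_ : ∀ {f g h : FPS} → f ≐ g → g ≐ h → f ≐ h
(e ≐-trans e') n i j = trans (e n i j) (e' n i j)

⊕-cong : ∀ {f f' g g' : FPS} → f ≐ f' → g ≐ g' → f ⊕ g ≐ f' ⊕ g'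
⊕-cong e e' n i j = cong₂ _+ℤ_ (e n i j) (e' n i j)

⊖-cong : ∀ {f f' : FPS} → f ≐ f' → ⊖ f ≐ ⊖ f'
⊖-cong e n i j = cong -ℤ_ (e n i j)

-- Multiplication by x^a y^b z^c; the guards discard the junk values of truncated subtraction.
shift : ℕ → ℕ → ℕ → FPS → FPS
shift a b c f n i j = guard≤ a n (guard≤ b i (guard≤ c j (f (n ∸ a) (i ∸ b) (j ∸ c))))

⊛-cong : ∀ {f f' g g' : FPS} → f ≐ f' → g ≐ g' → f ⊛ g ≐ f' ⊛ g'
⊛-cong e e' n i j = Σ≤-cong n λ a → Σ≤-cong i λ b → Σ≤-cong j λ c →
  cong₂ _*ℤ_ (e a b c) (e' (n ∸ a) (i ∸ b) (j ∸ c))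

⊛-distribˡ-⊕ : ∀ (f g h : FPS) → f ⊛ (g ⊕ h) ≐ f ⊛ g ⊕ f ⊛ h
⊛-distribˡ-⊕ f g h n i j =
  trans (Σ≤-cong n λ a → trans (Σ≤-cong i λ b →
           trans (Σ≤-cong j λ c → ℤ.*-distribˡ-+ (f a b c) _ _) (Σ≤-+ j _ _))
         (Σ≤-+ i _ _))
        (Σ≤-+ n _ _)

⊛-distribˡ-⊖ : ∀ (f g : FPS) → f ⊛ (⊖ g) ≐ ⊖ (f ⊛ g)
⊛-distribˡ-⊖ f g n i j =
  trans (Σ≤-cong n λ a → trans (Σ≤-cong i λ b →
           trans (Σ≤-cong j λ c → sym (ℤ.neg-distribʳ-* (f a b c) _)) (Σ≤-neg j _))
         (Σ≤-neg i _))
        (Σ≤-neg n _)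

⊛-mono : ∀ a b c (f : FPS) → f ⊛ mono a b c ≐ shift a b c f
⊛-mono a b c f n i j = begin
  Σ≤ n (λ a' → Σ≤ i (λ b' → Σ≤ j (λ c' → f a' b' c' *ℤ 𝟙 (α a' ∧ β b' ∧ γ c'))))
    ≡⟨ (Σ≤-cong n λ a' → Σ≤-cong i λ b' → Σ≤-cong j λ c' → split (α a') (β b') (γ c') (f a' b' c')) ⟩
  Σ≤ n (λ a' → Σ≤ i (λ b' → Σ≤ j (λ c' → f a' b' c' *ℤ 𝟙 (γ c') *ℤ 𝟙 (β b') *ℤ 𝟙 (α a'))))
    ≡⟨ (Σ≤-cong n λ a' → Σ≤-cong i λ b' → trans (Σ≤-*ʳ j _ _) (cong (_*ℤ 𝟙 (α a'))
          (trans (Σ≤-*ʳ j _ _) (cong (_*ℤ 𝟙 (β b')) (Σ≤-selectʳ c j (f a' b')))))) ⟩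
  Σ≤ n (λ a' → Σ≤ i (λ b' → guard≤ c j (f a' b' (j ∸ c)) *ℤ 𝟙 (β b') *ℤ 𝟙 (α a')))
    ≡⟨ (Σ≤-cong n λ a' → trans (Σ≤-*ʳ i _ _)
          (cong (_*ℤ 𝟙 (α a')) (Σ≤-selectʳ b i λ b' → guard≤ c j (f a' b' (j ∸ c))))) ⟩
  Σ≤ n (λ a' → guard≤ b i (guard≤ c j (f a' (i ∸ b) (j ∸ c))) *ℤ 𝟙 (α a'))
    ≡⟨ Σ≤-selectʳ a n (λ a' → guard≤ b i (guard≤ c j (f a' (i ∸ b) (j ∸ c)))) ⟩
  shift a b c f n i j ∎
  where
  α = λ a' → n ∸ a' ≡ᵇ a
  β = λ b' → i ∸ b' ≡ᵇ b
  γ = λ c' → j ∸ c' ≡ᵇ c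
  split : ∀ p q r x → x *ℤ 𝟙 (p ∧ q ∧ r) ≡ x *ℤ 𝟙 r *ℤ 𝟙 q *ℤ 𝟙 p
  split p q r x = trans (cong (x *ℤ_) (trans (𝟙-∧ p _) (cong (𝟙 p *ℤ_) (𝟙-∧ q r))))
                        (rearrange x (𝟙 p) (𝟙 q) (𝟙 r))
    where
    rearrange : ∀ x p q r → x *ℤ (p *ℤ (q *ℤ r)) ≡ x *ℤ r *ℤ q *ℤ p
    rearrange = solve-∀

mono-⊛ : ∀ a b c (f : FPS) → mono a b c ⊛ f ≐ shift a b c f
mono-⊛ a b c f n i j = begin
  Σ≤ n (λ a' → Σ≤ i (λ b' → Σ≤ j (λ c' → 𝟙 (α a' ∧ β b' ∧ γ c') *ℤ g a' b' c')))
    ≡⟨ (Σ≤-cong n λ a' → Σ≤-cong i λ b' → Σ≤-cong j λ c' → split (α a') (β b') (γ c') (g a' b' c')) ⟩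
  Σ≤ n (λ a' → Σ≤ i (λ b' → Σ≤ j (λ c' → 𝟙 (α a') *ℤ (𝟙 (β b') *ℤ (𝟙 (γ c') *ℤ g a' b' c')))))
    ≡⟨ (Σ≤-cong n λ a' → Σ≤-cong i λ b' →
          trans (Σ≤-*ˡ j (𝟙 (α a')) λ c' → 𝟙 (β b') *ℤ (𝟙 (γ c') *ℤ g a' b' c')) (cong (𝟙 (α a') *ℤ_)
          (trans (Σ≤-*ˡ j (𝟙 (β b')) λ c' → 𝟙 (γ c') *ℤ g a' b' c')
                 (cong (𝟙 (β b') *ℤ_) (Σ≤-selectˡ c j (g a' b')))))) ⟩
  Σ≤ n (λ a' → Σ≤ i (λ b' → 𝟙 (α a') *ℤ (𝟙 (β b') *ℤ guard≤ c j (g a' b' c))))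
    ≡⟨ (Σ≤-cong n λ a' → trans (Σ≤-*ˡ i (𝟙 (α a')) λ b' → 𝟙 (β b') *ℤ guard≤ c j (g a' b' c))
          (cong (𝟙 (α a') *ℤ_) (Σ≤-selectˡ b i λ b' → guard≤ c j (g a' b' c)))) ⟩
  Σ≤ n (λ a' → 𝟙 (α a') *ℤ guard≤ b i (guard≤ c j (g a' b c)))
    ≡⟨ Σ≤-selectˡ a n (λ a' → guard≤ b i (guard≤ c j (g a' b c))) ⟩
  shift a b c f n i j ∎
  where
  α = λ a' → a' ≡ᵇ a
  β = λ b' → b' ≡ᵇ b
  γ = λ c' → c' ≡ᵇ c
  g : ℕ → ℕ → ℕ → ℤ
  g a' b' c' = f (n ∸ a') (i ∸ b') (j ∸ c')
  split : ∀ p q r x → 𝟙 (p ∧ q ∧ r) *ℤ x ≡ 𝟙 p *ℤ (𝟙 q *ℤ (𝟙 r *ℤ x))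
  split p q r x = trans (cong (_*ℤ x) (trans (𝟙-∧ p _) (cong (𝟙 p *ℤ_) (𝟙-∧ q r))))
                        (reassociate (𝟙 p) (𝟙 q) (𝟙 r) x)
    where
    reassociate : ∀ p q r x → p *ℤ (q *ℤ r) *ℤ x ≡ p *ℤ (q *ℤ (r *ℤ x))
    reassociate = solve-∀

mono-⊛-mono : ∀ a b c a' b' c' → mono a b c ⊛ mono a' b' c' ≐ mono (a + a') (b + b') (c + c')
mono-⊛-mono a b c a' b' c' n i j = begin
  (mono a b c ⊛ mono a' b' c') n i j
    ≡⟨ mono-⊛ a b c (mono a' b' c') n i j ⟩
  guard≤ a n (guard≤ b i (guard≤ c j (𝟙 (α ∧ β ∧ γ))))
    ≡⟨ cong (guard≤ a n ∘ guard≤ b i ∘ guard≤ c j) (trans (𝟙-∧ α _) (cong (𝟙 α *ℤ_) (𝟙-∧ β γ))) ⟩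
  guard≤ a n (guard≤ b i (guard≤ c j (𝟙 α *ℤ (𝟙 β *ℤ 𝟙 γ))))
    ≡⟨ cong (guard≤ a n ∘ guard≤ b i)
         (trans (guard≤-*ʳ c j (𝟙 α) _) (cong (𝟙 α *ℤ_) (guard≤-*ʳ c j (𝟙 β) _))) ⟩
  guard≤ a n (guard≤ b i (𝟙 α *ℤ (𝟙 β *ℤ guard≤ c j (𝟙 γ))))
    ≡⟨ cong (guard≤ a n)
         (trans (guard≤-*ʳ b i (𝟙 α) _) (cong (𝟙 α *ℤ_) (guard≤-*ˡ b i (𝟙 β) _))) ⟩
  guard≤ a n (𝟙 α *ℤ (guard≤ b i (𝟙 β) *ℤ guard≤ c j (𝟙 γ)))
    ≡⟨ guard≤-*ˡ a n (𝟙 α) _ ⟩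
  guard≤ a n (𝟙 α) *ℤ (guard≤ b i (𝟙 β) *ℤ guard≤ c j (𝟙 γ))
    ≡⟨ cong₂ _*ℤ_ (guard≤-𝟙 a a' n) (cong₂ _*ℤ_ (guard≤-𝟙 b b' i) (guard≤-𝟙 c c' j)) ⟩
  𝟙 (n ≡ᵇ a + a') *ℤ (𝟙 (i ≡ᵇ b + b') *ℤ 𝟙 (j ≡ᵇ c + c'))
    ≡⟨ sym (trans (𝟙-∧ (n ≡ᵇ a + a') _) (cong (𝟙 (n ≡ᵇ a + a') *ℤ_) (𝟙-∧ (i ≡ᵇ b + b') _))) ⟩
  mono (a + a') (b + b') (c + c') n i j ∎
  where
  α = n ∸ a ≡ᵇ a'
  β = i ∸ b ≡ᵇ b'
  γ = j ∸ c ≡ᵇ c'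

sumWords : ℕ → (Path → ℤ) → ℤ
sumWords zero F = F []
sumWords (suc m) F = sumWords m (λ w → F (U ∷ w)) +ℤ sumWords m (λ w → F (D ∷ w))

sumWords-cong : ∀ m {F G : Path → ℤ} → (∀ w → length w ≡ m → F w ≡ G w) → sumWords m F ≡ sumWords m G
sumWords-cong zero e = e [] refl
sumWords-cong (suc m) e =
  cong₂ _+ℤ_ (sumWords-cong m λ w l → e (U ∷ w) (cong suc l)) (sumWords-cong m λ w l → e (D ∷ w) (cong suc l))

sumWords-zero : ∀ m → sumWords m (λ _ → +0) ≡ +0
sumWords-zero zero = refl
sumWords-zero (suc m) = cong₂ _+ℤ_ (sumWords-zero m) (sumWords-zero m)

sumWords-+ : ∀ m (F G : Path → ℤ) → sumWords m (λ w → F w +ℤ G w) ≡ sumWords m F +ℤ sumWords m G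
sumWords-+ zero F G = refl
sumWords-+ (suc m) F G =
  trans (cong₂ _+ℤ_ (sumWords-+ m (F ∘ (U ∷_)) (G ∘ (U ∷_))) (sumWords-+ m (F ∘ (D ∷_)) (G ∘ (D ∷_))))
        (+-interchange (sumWords m (F ∘ (U ∷_))) (sumWords m (G ∘ (U ∷_)))
                       (sumWords m (F ∘ (D ∷_))) (sumWords m (G ∘ (D ∷_))))

sumWords-*ˡ : ∀ m x (F : Path → ℤ) → sumWords m (λ w → x *ℤ F w) ≡ x *ℤ sumWords m F
sumWords-*ˡ zero x F = refl
sumWords-*ˡ (suc m) x F = trans (cong₂ _+ℤ_ (sumWords-*ˡ m x _) (sumWords-*ˡ m x _))
                                (sym (ℤ.*-distribˡ-+ x _ _))

sumWords-*ʳ : ∀ m x (F : Path → ℤ) → sumWords m (λ w → F w *ℤ x) ≡ sumWords m F *ℤ x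
sumWords-*ʳ m x F = trans (sumWords-cong m λ w _ → ℤ.*-comm (F w) x)
                          (trans (sumWords-*ˡ m x F) (ℤ.*-comm x _))

sumWords-Σ≤ : ∀ m n (F : ℕ → Path → ℤ) → sumWords m (λ w → Σ≤ n (λ k → F k w)) ≡ Σ≤ n (λ k → sumWords m (F k))
sumWords-Σ≤ zero n F = refl
sumWords-Σ≤ (suc m) n F = trans (cong₂ _+ℤ_ (sumWords-Σ≤ m n _) (sumWords-Σ≤ m n _)) (sym (Σ≤-+ n _ _))

sumWords-guard≤ : ∀ m e n (F : Path → ℤ) → sumWords m (λ w → guard≤ e n (F w)) ≡ guard≤ e n (sumWords m F)
sumWords-guard≤ m zero n F = refl
sumWords-guard≤ m (suc e) zero F = sumWords-zero m
sumWords-guard≤ m (suc e) (suc n) F = sumWords-guard≤ m e n F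

sumWords-++ : ∀ a b (F : Path → ℤ) → sumWords (a + b) F ≡ sumWords a (λ u → sumWords b (λ v → F (u ++ v)))
sumWords-++ zero b F = refl
sumWords-++ (suc a) b F = cong₂ _+ℤ_ (sumWords-++ a b _) (sumWords-++ a b _)

splits : (Path → Path → ℤ) → Path → ℤ
splits F [] = F [] []
splits F (x ∷ w) = F [] (x ∷ w) +ℤ splits (λ u → F (x ∷ u)) w

splits-cong : ∀ {F G : Path → Path → ℤ} → (∀ u v → F u v ≡ G u v) → ∀ w → splits F w ≡ splits G w
splits-cong e [] = e [] []
splits-cong e (x ∷ w) = cong₂ _+ℤ_ (e [] (x ∷ w)) (splits-cong (λ u → e (x ∷ u)) w)

splits-zero : ∀ w → splits (λ _ _ → +0) w ≡ +0
splits-zero [] = refl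
splits-zero (x ∷ w) = cong (+0 +ℤ_) (splits-zero w)

splits-*ʳ : ∀ (F : Path → Path → ℤ) (G : Path → ℤ) w →
            splits F w *ℤ G w ≡ splits (λ u v → F u v *ℤ G (u ++ v)) w
splits-*ʳ F G [] = refl
splits-*ʳ F G (x ∷ w) = trans (ℤ.*-distribʳ-+ (G (x ∷ w)) (F [] (x ∷ w)) _)
                              (cong (F [] (x ∷ w) *ℤ G (x ∷ w) +ℤ_) (splits-*ʳ (λ u → F (x ∷ u)) (G ∘ (x ∷_)) w))

sumWords-splits : ∀ m (F : Path → Path → ℤ) →
                  sumWords m (splits F) ≡ Σ≤ m (λ p → sumWords p (λ u → sumWords (m ∸ p) (F u)))
sumWords-splits zero F = refl
sumWords-splits (suc m) F = begin
  sumWords m (λ w → F [] (U ∷ w) +ℤ splits (F ∘ (U ∷_)) w)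
    +ℤ sumWords m (λ w → F [] (D ∷ w) +ℤ splits (F ∘ (D ∷_)) w)
    ≡⟨ cong₂ _+ℤ_ (sumWords-+ m _ _) (sumWords-+ m _ _) ⟩
  (sumWords m (F [] ∘ (U ∷_)) +ℤ sumWords m (splits (F ∘ (U ∷_))))
    +ℤ (sumWords m (F [] ∘ (D ∷_)) +ℤ sumWords m (splits (F ∘ (D ∷_))))
    ≡⟨ +-interchange (sumWords m (F [] ∘ (U ∷_))) (sumWords m (splits (F ∘ (U ∷_))))
                     (sumWords m (F [] ∘ (D ∷_))) (sumWords m (splits (F ∘ (D ∷_)))) ⟩
  sumWords (suc m) (F []) +ℤ (sumWords m (splits (F ∘ (U ∷_))) +ℤ sumWords m (splits (F ∘ (D ∷_))))
    ≡⟨ cong (sumWords (suc m) (F []) +ℤ_)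
         (trans (cong₂ _+ℤ_ (sumWords-splits m (F ∘ (U ∷_))) (sumWords-splits m (F ∘ (D ∷_))))
                (sym (Σ≤-+ m _ _))) ⟩
  sumWords (suc m) (F []) +ℤ Σ≤ m (λ p → sumWords (suc p) (λ u → sumWords (m ∸ p) (F u)))
    ≡⟨ sym (Σ≤-suc m _) ⟩
  Σ≤ (suc m) (λ p → sumWords p (λ u → sumWords (suc m ∸ p) (F u))) ∎

sumWords-splits-double : ∀ n (G : Path → Path → ℤ) → (∀ a u v → length u ≡ suc (double a) → G u v ≡ +0) →
  sumWords (double n) (splits G) ≡ Σ≤ n (λ a → sumWords (double a) (λ u → sumWords (double (n ∸ a)) (G u)))
sumWords-splits-double n G odd = begin
  sumWords (double n) (splits G)
    ≡⟨ sumWords-splits (double n) G ⟩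
  Σ≤ (double n) (λ p → sumWords p (λ u → sumWords (double n ∸ p) (G u)))
    ≡⟨ Σ≤-double n _ oddPrefix ⟩
  Σ≤ n (λ a → sumWords (double a) (λ u → sumWords (double n ∸ double a) (G u)))
    ≡⟨ (Σ≤-cong n λ a → cong (λ m → sumWords (double a) (λ u → sumWords m (G u))) (double-∸ n a)) ⟩
  Σ≤ n (λ a → sumWords (double a) (λ u → sumWords (double (n ∸ a)) (G u))) ∎
  where
  oddPrefix : ∀ a → sumWords (suc (double a)) (λ u → sumWords (double n ∸ suc (double a)) (G u)) ≡ +0
  oddPrefix a = trans (sumWords-cong (suc (double a)) λ u l →
                         trans (sumWords-cong rest λ v _ → odd a u v l) (sumWords-zero rest))
                      (sumWords-zero (suc (double a)))
    where
    rest = double n ∸ suc (double a)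

sumList : List Path → (Path → ℤ) → ℤ
sumList [] F = +0
sumList (w ∷ ws) F = F w +ℤ sumList ws F

sumList-++ : ∀ ws vs (F : Path → ℤ) → sumList (ws ++ vs) F ≡ sumList ws F +ℤ sumList vs F
sumList-++ [] vs F = sym (ℤ.+-identityˡ _)
sumList-++ (w ∷ ws) vs F = trans (cong (F w +ℤ_) (sumList-++ ws vs F)) (sym (ℤ.+-assoc (F w) _ _))

sumList-map : ∀ (g : Path → Path) ws (F : Path → ℤ) → sumList (map g ws) F ≡ sumList ws (F ∘ g)
sumList-map g [] F = refl
sumList-map g (w ∷ ws) F = cong (F (g w) +ℤ_) (sumList-map g ws F)

sumList-words : ∀ m (F : Path → ℤ) → sumList (words m) F ≡ sumWords m F
sumList-words zero F = ℤ.+-identityʳ (F [])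
sumList-words (suc m) F = begin
  sumList (map (U ∷_) (words m) ++ map (D ∷_) (words m)) F
    ≡⟨ sumList-++ (map (U ∷_) (words m)) _ F ⟩
  sumList (map (U ∷_) (words m)) F +ℤ sumList (map (D ∷_) (words m)) F
    ≡⟨ cong₂ _+ℤ_ (trans (sumList-map (U ∷_) (words m) F) (sumList-words m _))
                  (trans (sumList-map (D ∷_) (words m) F) (sumList-words m _)) ⟩
  sumWords (suc m) F ∎

length-filter : ∀ (g : Path → Bool) ws →
                + length (filter (λ w → T? (g w)) ws) ≡ sumList ws (λ w → 𝟙 (g w))
length-filter g [] = refl
length-filter g (w ∷ ws) with g w
... | true = cong (+ 1 +ℤ_) (length-filter g ws)
... | false = trans (length-filter g ws) (sym (ℤ.+-identityˡ _))

sumList-filter : ∀ (g : Path → Bool) (F : Path → ℤ) ws →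
                 sumList (filter (λ w → T? (g w)) ws) F ≡ sumList ws (λ w → 𝟙 (g w) *ℤ F w)
sumList-filter g F [] = refl
sumList-filter g F (w ∷ ws) with g w
... | true = cong₂ _+ℤ_ (sym (ℤ.*-identityˡ (F w))) (sumList-filter g F ws)
... | false = trans (sumList-filter g F ws) (sym (ℤ.+-identityˡ _))

filter-filter : ∀ (p q : Path → Bool) ws →
                filter (λ w → T? (q w)) (filter (λ w → T? (p w)) ws) ≡ filter (λ w → T? (p w ∧ q w)) ws
filter-filter p q [] = refl
filter-filter p q (w ∷ ws) with p w
... | false = filter-filter p q ws
... | true with q w
...   | true = cong (w ∷_) (filter-filter p q ws)
...   | false = filter-filter p q ws

isDyck⁺ : Path → Bool
isDyck⁺ w = isDyck w ∧ not (null w)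

returnsExactly : ℕ → ℕ → Path → Bool
returnsExactly r h w = walk h w ∧ (rets h w ≡ᵇ r)

isIrreducible : Path → Bool
isIrreducible = returnsExactly 1 0

returnsExactly-zero-suc : ∀ h w → returnsExactly 0 (suc h) w ≡ false
returnsExactly-zero-suc h [] = refl
returnsExactly-zero-suc h (U ∷ w) = returnsExactly-zero-suc (suc h) w
returnsExactly-zero-suc zero (D ∷ w) = ∧-zeroʳ (walk 0 w)
returnsExactly-zero-suc (suc h) (D ∷ w) = returnsExactly-zero-suc h w

returnsExactly-zero-∷ : ∀ x w → returnsExactly 0 0 (x ∷ w) ≡ false
returnsExactly-zero-∷ U w = returnsExactly-zero-suc 0 w
returnsExactly-zero-∷ D w = refl

returnsExactly-one-++D : ∀ h w → returnsExactly 1 (suc h) (w ++ D ∷ []) ≡ walk h w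
returnsExactly-one-++D zero [] = refl
returnsExactly-one-++D (suc h) [] = refl
returnsExactly-one-++D h (U ∷ w) = returnsExactly-one-++D (suc h) w
returnsExactly-one-++D (suc h) (D ∷ w) = returnsExactly-one-++D h w
returnsExactly-one-++D zero (D ∷ []) = refl
returnsExactly-one-++D zero (D ∷ x ∷ w) = returnsExactly-zero-∷ x (w ++ D ∷ [])

walk-++U : ∀ h w → walk h (w ++ U ∷ []) ≡ false
walk-++U h [] = refl
walk-++U h (U ∷ w) = walk-++U (suc h) w
walk-++U zero (D ∷ w) = refl
walk-++U (suc h) (D ∷ w) = walk-++U h w

walk-++UD : ∀ h w → walk h (w ++ U ∷ D ∷ []) ≡ walk h w
walk-++UD h [] = refl
walk-++UD h (U ∷ w) = walk-++UD (suc h) w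
walk-++UD zero (D ∷ w) = refl
walk-++UD (suc h) (D ∷ w) = walk-++UD h w

isEven : ℕ → Bool
isEven zero = true
isEven (suc zero) = false
isEven (suc (suc n)) = isEven n

walk-isEven : ∀ h w → walk h w ≡ true → isEven (h + length w) ≡ true
walk-isEven zero [] e = refl
walk-isEven h (U ∷ w) e = trans (cong isEven (ℕ.+-suc h (length w))) (walk-isEven (suc h) w e)
walk-isEven (suc h) (D ∷ w) e =
  trans (cong (isEven ∘ suc) (ℕ.+-suc h (length w))) (walk-isEven h w e)

isEven-odd : ∀ a → isEven (suc (double a)) ≡ false
isEven-odd zero = refl
isEven-odd (suc a) = isEven-odd a

isIrreducible-odd : ∀ a w → length w ≡ suc (double a) → isIrreducible w ≡ false
isIrreducible-odd a w l with walk 0 w in e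
... | false = refl
... | true with () ← trans (sym (walk-isEven 0 w e)) (trans (cong isEven l) (isEven-odd a))

endsWithD : Path → Bool
endsWithD [] = false
endsWithD (U ∷ []) = false
endsWithD (D ∷ []) = true
endsWithD (_ ∷ y ∷ w) = endsWithD (y ∷ w)

walk-endsWithD : ∀ h x w → walk h (x ∷ w) ≡ true → endsWithD (x ∷ w) ≡ true
walk-endsWithD h U (y ∷ w) e = walk-endsWithD (suc h) y w e
walk-endsWithD h D [] e = refl
walk-endsWithD (suc h) D (y ∷ w) e = walk-endsWithD h y w e

valleys-++U : ∀ u v → endsWithD u ≡ true → valleys (u ++ U ∷ v) ≡ suc (valleys u + valleys (U ∷ v))
valleys-++U (U ∷ y ∷ u) v e = valleys-++U (y ∷ u) v e
valleys-++U (D ∷ []) v e = refl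
valleys-++U (D ∷ U ∷ u) v e = cong suc (valleys-++U (U ∷ u) v e)
valleys-++U (D ∷ D ∷ u) v e = valleys-++U (D ∷ u) v e

tfalls-++U : ∀ u v → tfalls (u ++ U ∷ v) ≡ tfalls u + tfalls (U ∷ v)
tfalls-++U [] v = refl
tfalls-++U (U ∷ u) v = tfalls-++U u v
tfalls-++U (D ∷ []) v = refl
tfalls-++U (D ∷ U ∷ u) v = tfalls-++U (U ∷ u) v
tfalls-++U (D ∷ D ∷ []) v = refl
tfalls-++U (D ∷ D ∷ U ∷ u) v = tfalls-++U (D ∷ U ∷ u) v
tfalls-++U (D ∷ D ∷ D ∷ u) v = cong suc (tfalls-++U (D ∷ D ∷ u) v)

valleys-++D : ∀ w → valleys (w ++ D ∷ []) ≡ valleys w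
valleys-++D [] = refl
valleys-++D (U ∷ w) = valleys-++D w
valleys-++D (D ∷ []) = refl
valleys-++D (D ∷ U ∷ w) = cong suc (valleys-++D (U ∷ w))
valleys-++D (D ∷ D ∷ w) = valleys-++D (D ∷ w)

tfalls-++DDD : ∀ w → tfalls (w ++ D ∷ D ∷ D ∷ []) ≡ suc (tfalls (w ++ D ∷ D ∷ []))
tfalls-++DDD [] = refl
tfalls-++DDD (U ∷ w) = tfalls-++DDD w
tfalls-++DDD (D ∷ []) = refl
tfalls-++DDD (D ∷ U ∷ w) = tfalls-++DDD (U ∷ w)
tfalls-++DDD (D ∷ D ∷ []) = refl
tfalls-++DDD (D ∷ D ∷ U ∷ w) = tfalls-++DDD (D ∷ U ∷ w)
tfalls-++DDD (D ∷ D ∷ D ∷ w) = cong suc (tfalls-++DDD (D ∷ D ∷ w))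

stat : ℕ → ℕ → Path → ℤ
stat i j w = 𝟙 ((i ≡ᵇ valleys w) ∧ (j ≡ᵇ tfalls w))

count : (Path → Bool) → (Path → ℕ) → (Path → ℕ) → FPS
count P v t n i j = sumWords (double n) (λ w → 𝟙 (P w) *ℤ 𝟙 ((i ≡ᵇ v w) ∧ (j ≡ᵇ t w)))

gf≡count : ∀ (P : Path → Bool) n i j →
  + length (filter (λ w → T? ((valleys w ≡ᵇ i) ∧ (tfalls w ≡ᵇ j))) (filter (λ w → T? (P w)) (words (2 * n))))
  ≡ count P valleys tfalls n i j
gf≡count P n i j = begin
  + length (filter (λ w → T? (S w)) (filter (λ w → T? (P w)) W))
    ≡⟨ length-filter S (filter (λ w → T? (P w)) W) ⟩
  sumList (filter (λ w → T? (P w)) W) (𝟙 ∘ S)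
    ≡⟨ sumList-filter P (𝟙 ∘ S) W ⟩
  sumList W (λ w → 𝟙 (P w) *ℤ 𝟙 (S w))
    ≡⟨ sumList-words (2 * n) (λ w → 𝟙 (P w) *ℤ 𝟙 (S w)) ⟩
  sumWords (2 * n) (λ w → 𝟙 (P w) *ℤ 𝟙 (S w))
    ≡⟨ cong (λ m → sumWords m (λ w → 𝟙 (P w) *ℤ 𝟙 (S w))) (2*≡double n) ⟩
  sumWords (double n) (λ w → 𝟙 (P w) *ℤ 𝟙 (S w))
    ≡⟨ sumWords-cong (double n) (λ w _ → cong (λ b → 𝟙 (P w) *ℤ 𝟙 b)
         (cong₂ _∧_ (≡ᵇ-sym (valleys w) i) (≡ᵇ-sym (tfalls w) j))) ⟩
  count P valleys tfalls n i j ∎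
  where
  W = words (2 * n)
  S : Path → Bool
  S w = (valleys w ≡ᵇ i) ∧ (tfalls w ≡ᵇ j)

A⊝one : A ⊝ one ≐ count isDyck⁺ valleys tfalls
A⊝one zero zero zero = refl
A⊝one zero zero (suc j) = refl
A⊝one zero (suc i) zero = refl
A⊝one zero (suc i) (suc j) = refl
A⊝one (suc n) i j = begin
  A (suc n) i j +ℤ +0                        ≡⟨ ℤ.+-identityʳ _ ⟩
  A (suc n) i j                              ≡⟨ gf≡count isDyck (suc n) i j ⟩
  count isDyck valleys tfalls (suc n) i j   ≡⟨ sumWords-cong (double (suc n)) nonempty ⟩
  count isDyck⁺ valleys tfalls (suc n) i j ∎
  where
  nonempty : ∀ w → length w ≡ double (suc n) → 𝟙 (isDyck w) *ℤ stat i j w ≡ 𝟙 (isDyck⁺ w) *ℤ stat i j w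
  nonempty (x ∷ w) _ = cong (λ b → 𝟙 b *ℤ stat i j (x ∷ w)) (sym (∧-identityʳ (isDyck (x ∷ w))))

B⊝one : B ⊝ one ≐ count isIrreducible valleys tfalls
B⊝one zero zero zero = refl
B⊝one zero zero (suc j) = refl
B⊝one zero (suc i) zero = refl
B⊝one zero (suc i) (suc j) = refl
B⊝one (suc n) i j =
  trans (ℤ.+-identityʳ _)
        (trans (cong (λ ws → + length (filter (λ w → T? ((valleys w ≡ᵇ i) ∧ (tfalls w ≡ᵇ j))) ws))
                     (filter-filter isDyck (λ w → returns w ≡ᵇ 1) (words (2 * suc n))))
               (gf≡count isIrreducible (suc n) i j))

count-sucᵛ : ∀ P v t n i j → count P (suc ∘ v) t n i j ≡ guard≤ 1 i (count P v t n (i ∸ 1) j)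
count-sucᵛ P v t n zero j =
  trans (sumWords-cong (double n) λ w _ → ℤ.*-zeroʳ (𝟙 (P w))) (sumWords-zero (double n))
count-sucᵛ P v t n (suc i) j = refl

Y⊛count : ∀ P v t → Y ⊛ count P v t ≐ count P (suc ∘ v) t
Y⊛count P v t n i j = trans (mono-⊛ 0 1 0 (count P v t) n i j) (sym (count-sucᵛ P v t n i j))

𝟙-convolution : ∀ i x y → Σ≤ i (λ b → 𝟙 (b ≡ᵇ x) *ℤ 𝟙 (i ∸ b ≡ᵇ y)) ≡ 𝟙 (i ≡ᵇ x + y)
𝟙-convolution i x y = trans (Σ≤-selectˡ x i λ b → 𝟙 (i ∸ b ≡ᵇ y)) (guard≤-𝟙 x y i)

𝟙-convolution² : ∀ i j x y z w →
  Σ≤ i (λ b → Σ≤ j (λ c → 𝟙 ((b ≡ᵇ x) ∧ (c ≡ᵇ z)) *ℤ 𝟙 ((i ∸ b ≡ᵇ y) ∧ (j ∸ c ≡ᵇ w))))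
  ≡ 𝟙 ((i ≡ᵇ x + y) ∧ (j ≡ᵇ z + w))
𝟙-convolution² i j x y z w = begin
  Σ≤ i (λ b → Σ≤ j (λ c → 𝟙 ((b ≡ᵇ x) ∧ (c ≡ᵇ z)) *ℤ 𝟙 ((i ∸ b ≡ᵇ y) ∧ (j ∸ c ≡ᵇ w))))
    ≡⟨ (Σ≤-cong i λ b → Σ≤-cong j λ c → factor (b ≡ᵇ x) (c ≡ᵇ z) (i ∸ b ≡ᵇ y) (j ∸ c ≡ᵇ w)) ⟩
  Σ≤ i (λ b → Σ≤ j (λ c → f b *ℤ g c))
    ≡⟨ (Σ≤-cong i λ b → Σ≤-*ˡ j (f b) g) ⟩
  Σ≤ i (λ b → f b *ℤ Σ≤ j g)
    ≡⟨ Σ≤-*ʳ i (Σ≤ j g) f ⟩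
  Σ≤ i f *ℤ Σ≤ j g
    ≡⟨ cong₂ _*ℤ_ (𝟙-convolution i x y) (𝟙-convolution j z w) ⟩
  𝟙 (i ≡ᵇ x + y) *ℤ 𝟙 (j ≡ᵇ z + w)
    ≡⟨ sym (𝟙-∧ (i ≡ᵇ x + y) _) ⟩
  𝟙 ((i ≡ᵇ x + y) ∧ (j ≡ᵇ z + w)) ∎
  where
  f g : ℕ → ℤ
  f b = 𝟙 (b ≡ᵇ x) *ℤ 𝟙 (i ∸ b ≡ᵇ y)
  g c = 𝟙 (c ≡ᵇ z) *ℤ 𝟙 (j ∸ c ≡ᵇ w)
  factor : ∀ p q r s → 𝟙 (p ∧ q) *ℤ 𝟙 (r ∧ s) ≡ 𝟙 p *ℤ 𝟙 r *ℤ (𝟙 q *ℤ 𝟙 s)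
  factor p q r s = trans (cong₂ _*ℤ_ (𝟙-∧ p q) (𝟙-∧ r s)) (swap (𝟙 p) (𝟙 q) (𝟙 r) (𝟙 s))
    where
    swap : ∀ p q r s → p *ℤ q *ℤ (r *ℤ s) ≡ p *ℤ r *ℤ (q *ℤ s)
    swap = solve-∀

count-⊛ : ∀ P Q v v' t t' n i j → (count P v t ⊛ count Q v' t') n i j ≡
  Σ≤ n (λ a → sumWords (double a) (λ u → sumWords (double (n ∸ a)) (λ w →
    𝟙 (P u) *ℤ 𝟙 (Q w) *ℤ 𝟙 ((i ≡ᵇ v u + v' w) ∧ (j ≡ᵇ t u + t' w)))))
count-⊛ P Q v v' t t' n i j = Σ≤-cong n λ a → begin
  Σ≤ i (λ b → Σ≤ j (λ c → sumWords (double a) (F b c) *ℤ sumWords (double (n ∸ a)) (G b c)))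
    ≡⟨ (Σ≤-cong i λ b → Σ≤-cong j λ c → product (double a) (double (n ∸ a)) (F b c) (G b c)) ⟩
  Σ≤ i (λ b → Σ≤ j (λ c → sumWords (double a) λ u → sumWords (double (n ∸ a)) λ w → F b c u *ℤ G b c w))
    ≡⟨ (Σ≤-cong i λ b → trans (sym (sumWords-Σ≤ (double a) j λ c u → sumWords (double (n ∸ a)) (H b c u)))
          (sumWords-cong (double a) λ u _ → sym (sumWords-Σ≤ (double (n ∸ a)) j λ c → H b c u))) ⟩
  Σ≤ i (λ b → sumWords (double a) λ u → sumWords (double (n ∸ a)) λ w → Σ≤ j λ c → F b c u *ℤ G b c w)
    ≡⟨ trans (sym (sumWords-Σ≤ (double a) i λ b u → sumWords (double (n ∸ a)) λ w → Σ≤ j λ c → H b c u w))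
          (sumWords-cong (double a) λ u _ → sym (sumWords-Σ≤ (double (n ∸ a)) i λ b w → Σ≤ j λ c → H b c u w)) ⟩
  sumWords (double a) (λ u → sumWords (double (n ∸ a)) λ w → Σ≤ i λ b → Σ≤ j λ c → F b c u *ℤ G b c w)
    ≡⟨ (sumWords-cong (double a) λ u _ → sumWords-cong (double (n ∸ a)) λ w _ → pointwise u w) ⟩
  sumWords (double a) (λ u → sumWords (double (n ∸ a)) λ w →
    𝟙 (P u) *ℤ 𝟙 (Q w) *ℤ 𝟙 ((i ≡ᵇ v u + v' w) ∧ (j ≡ᵇ t u + t' w))) ∎
  where
  F : ℕ → ℕ → Path → ℤ
  F b c u = 𝟙 (P u) *ℤ 𝟙 ((b ≡ᵇ v u) ∧ (c ≡ᵇ t u))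
  G : ℕ → ℕ → Path → ℤ
  G b c w = 𝟙 (Q w) *ℤ 𝟙 ((i ∸ b ≡ᵇ v' w) ∧ (j ∸ c ≡ᵇ t' w))
  H : ℕ → ℕ → Path → Path → ℤ
  H b c u w = F b c u *ℤ G b c w
  product : ∀ p q (F G : Path → ℤ) → sumWords p F *ℤ sumWords q G ≡ sumWords p (λ u → sumWords q (λ w → F u *ℤ G w))
  product p q F G = trans (sym (sumWords-*ʳ p (sumWords q G) F))
                          (sumWords-cong p λ u _ → sym (sumWords-*ˡ q (F u) G))
  regroup : ∀ p q r s → p *ℤ r *ℤ (q *ℤ s) ≡ p *ℤ q *ℤ (r *ℤ s)
  regroup = solve-∀
  pointwise : ∀ u w → Σ≤ i (λ b → Σ≤ j λ c → F b c u *ℤ G b c w) ≡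
              𝟙 (P u) *ℤ 𝟙 (Q w) *ℤ 𝟙 ((i ≡ᵇ v u + v' w) ∧ (j ≡ᵇ t u + t' w))
  pointwise u w = begin
    Σ≤ i (λ b → Σ≤ j λ c → F b c u *ℤ G b c w)
      ≡⟨ (Σ≤-cong i λ b → Σ≤-cong j λ c → regroup (𝟙 (P u)) (𝟙 (Q w)) _ _) ⟩
    Σ≤ i (λ b → Σ≤ j λ c → pq *ℤ (𝟙 ((b ≡ᵇ v u) ∧ (c ≡ᵇ t u)) *ℤ 𝟙 ((i ∸ b ≡ᵇ v' w) ∧ (j ∸ c ≡ᵇ t' w))))
      ≡⟨ trans (Σ≤-cong i λ b → Σ≤-*ˡ j pq _) (Σ≤-*ˡ i pq _) ⟩
    pq *ℤ Σ≤ i (λ b → Σ≤ j λ c → 𝟙 ((b ≡ᵇ v u) ∧ (c ≡ᵇ t u)) *ℤ 𝟙 ((i ∸ b ≡ᵇ v' w) ∧ (j ∸ c ≡ᵇ t' w)))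
      ≡⟨ cong (pq *ℤ_) (𝟙-convolution² i j (v u) (v' w) (t u) (t' w)) ⟩
    pq *ℤ 𝟙 ((i ≡ᵇ v u + v' w) ∧ (j ≡ᵇ t u + t' w)) ∎
    where
    pq = 𝟙 (P u) *ℤ 𝟙 (Q w)

-- First-return decomposition

firstReturn-ground : ∀ w → 𝟙 (isDyck w) ≡
  𝟙 (returnsExactly 0 0 w) +ℤ splits (λ u v → 𝟙 (returnsExactly 0 0 u) *ℤ 𝟙 (isDyck⁺ v)) w
firstReturn-ground [] = refl
firstReturn-ground (x ∷ w) = begin
  𝟙 (isDyck (x ∷ w))
    ≡⟨ cong 𝟙 (sym (∧-identityʳ (isDyck (x ∷ w)))) ⟩
  𝟙 (isDyck⁺ (x ∷ w))
    ≡⟨ sym (trans (cong₂ _+ℤ_ (ℤ.*-identityˡ (𝟙 (isDyck⁺ (x ∷ w)))) noReturn) (ℤ.+-identityʳ (𝟙 (isDyck⁺ (x ∷ w))))) ⟩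
  𝟙 true *ℤ 𝟙 (isDyck⁺ (x ∷ w)) +ℤ splits (λ u v → 𝟙 (returnsExactly 0 0 (x ∷ u)) *ℤ 𝟙 (isDyck⁺ v)) w
    ≡⟨ sym (trans (cong (_+ℤ splitsum) (cong 𝟙 (returnsExactly-zero-∷ x w))) (ℤ.+-identityˡ splitsum)) ⟩
  𝟙 (returnsExactly 0 0 (x ∷ w)) +ℤ splitsum ∎
  where
  splitsum = splits (λ u v → 𝟙 (returnsExactly 0 0 u) *ℤ 𝟙 (isDyck⁺ v)) (x ∷ w)
  noReturn : splits (λ u v → 𝟙 (returnsExactly 0 0 (x ∷ u)) *ℤ 𝟙 (isDyck⁺ v)) w ≡ +0
  noReturn = trans (splits-cong (λ u v → cong (λ b → 𝟙 b *ℤ 𝟙 (isDyck⁺ v)) (returnsExactly-zero-∷ x u)) w)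
                   (splits-zero w)

-- Only the factorisation at the first return to the axis contributes to the sum.
firstReturn-from : ∀ h w → 𝟙 (walk (suc h) w) ≡
  𝟙 (returnsExactly 1 (suc h) w) +ℤ splits (λ u v → 𝟙 (returnsExactly 1 (suc h) u) *ℤ 𝟙 (isDyck⁺ v)) w
firstReturn-from h [] = refl
firstReturn-from h (U ∷ w) =
  trans (firstReturn-from (suc h) w) (cong (𝟙 (returnsExactly 1 (suc (suc h)) w) +ℤ_) (sym (ℤ.+-identityˡ _)))
firstReturn-from zero (D ∷ w) =
  trans (firstReturn-ground w) (cong (𝟙 (returnsExactly 0 0 w) +ℤ_) (sym (ℤ.+-identityˡ _)))
firstReturn-from (suc h) (D ∷ w) =
  trans (firstReturn-from h w) (cong (𝟙 (returnsExactly 1 (suc h) w) +ℤ_) (sym (ℤ.+-identityˡ _)))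

firstReturn : ∀ w → 𝟙 (isDyck⁺ w) ≡ 𝟙 (isIrreducible w) +ℤ splits (λ u v → 𝟙 (isIrreducible u) *ℤ 𝟙 (isDyck⁺ v)) w
firstReturn [] = refl
firstReturn (U ∷ w) =
  trans (cong 𝟙 (∧-identityʳ (walk 1 w)))
        (trans (firstReturn-from 0 w) (cong (𝟙 (isIrreducible (U ∷ w)) +ℤ_) (sym (ℤ.+-identityˡ _))))
firstReturn (D ∷ w) = sym (trans (ℤ.+-identityˡ _) (trans (ℤ.+-identityˡ _) (splits-zero w)))

stat-++ : ∀ i j u v →
  𝟙 (isIrreducible u) *ℤ 𝟙 (isDyck⁺ v) *ℤ stat i j (u ++ v) ≡
  𝟙 (isIrreducible u) *ℤ 𝟙 (isDyck⁺ v) *ℤ 𝟙 ((i ≡ᵇ suc (valleys u) + valleys v) ∧ (j ≡ᵇ tfalls u + tfalls v))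
stat-++ i j u v with isIrreducible u in irr | isDyck⁺ v in dyck
... | false | _ = refl
... | true | false = refl
stat-++ i j (x ∷ u) (U ∷ v) | true | true =
  cong (λ s → + 1 *ℤ + 1 *ℤ s) (cong₂ (λ p q → 𝟙 ((i ≡ᵇ p) ∧ (j ≡ᵇ q)))
    (valleys-++U (x ∷ u) v (walk-endsWithD 0 x u (∧-true irr)))
    (tfalls-++U (x ∷ u) v))
  where
  ∧-true : ∀ {p q} → p ∧ q ≡ true → p ≡ true
  ∧-true {true} _ = refl

count-firstReturn : ∀ n i j →
  count isDyck⁺ valleys tfalls n i j ≡
  count isIrreducible valleys tfalls n i j +ℤ (count isIrreducible (suc ∘ valleys) tfalls ⊛ count isDyck⁺ valleys tfalls) n i j
count-firstReturn n i j = begin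
  sumWords (double n) (λ w → 𝟙 (isDyck⁺ w) *ℤ stat i j w)
    ≡⟨ (sumWords-cong (double n) λ w _ → trans (cong (_*ℤ stat i j w) (firstReturn w))
          (trans (ℤ.*-distribʳ-+ (stat i j w) (𝟙 (isIrreducible w)) _)
                 (cong (𝟙 (isIrreducible w) *ℤ stat i j w +ℤ_) (splits-*ʳ F (stat i j) w)))) ⟩
  sumWords (double n) (λ w → 𝟙 (isIrreducible w) *ℤ stat i j w +ℤ splits (λ u v → F u v *ℤ stat i j (u ++ v)) w)
    ≡⟨ sumWords-+ (double n) _ _ ⟩
  Bₙ +ℤ sumWords (double n) (splits (λ u v → F u v *ℤ stat i j (u ++ v)))
    ≡⟨ cong (Bₙ +ℤ_) (sumWords-cong (double n) λ w _ → splits-cong (stat-++ i j) w) ⟩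
  Bₙ +ℤ sumWords (double n) (splits G)
    ≡⟨ cong (Bₙ +ℤ_) (sumWords-splits-double n G odd) ⟩
  Bₙ +ℤ Σ≤ n (λ a → sumWords (double a) (λ u → sumWords (double (n ∸ a)) (G u)))
    ≡⟨ cong (Bₙ +ℤ_) (sym (count-⊛ isIrreducible isDyck⁺ (suc ∘ valleys) valleys tfalls tfalls n i j)) ⟩
  Bₙ +ℤ (count isIrreducible (suc ∘ valleys) tfalls ⊛ count isDyck⁺ valleys tfalls) n i j ∎
  where
  Bₙ = count isIrreducible valleys tfalls n i j
  F : Path → Path → ℤ
  F u v = 𝟙 (isIrreducible u) *ℤ 𝟙 (isDyck⁺ v)
  E : Path → Path → ℤ
  E u v = 𝟙 ((i ≡ᵇ suc (valleys u) + valleys v) ∧ (j ≡ᵇ tfalls u + tfalls v))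
  G : Path → Path → ℤ
  G u v = F u v *ℤ E u v
  odd : ∀ a u v → length u ≡ suc (double a) → G u v ≡ +0
  odd a u v l = cong (λ b → 𝟙 b *ℤ 𝟙 (isDyck⁺ v) *ℤ E u v) (isIrreducible-odd a u l)

-- Last steps and lifts

sumDyck : ℕ → (Path → ℤ) → ℤ
sumDyck n F = sumWords (double n) (λ w → 𝟙 (isDyck w) *ℤ F w)

sumDyckDD : ℕ → (Path → ℤ) → ℤ
sumDyckDD n F = sumWords (double n) (λ w → 𝟙 (isDyck (w ++ D ∷ D ∷ [])) *ℤ F (w ++ D ∷ D ∷ []))

isDyck-++U : ∀ w x → isDyck (w ++ x ∷ U ∷ []) ≡ false
isDyck-++U w x = trans (cong isDyck (sym (++-assoc w (x ∷ []) (U ∷ [])))) (walk-++U 0 (w ++ x ∷ []))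

sumDyck-suc : ∀ n (F : Path → ℤ) → sumDyck (suc n) F ≡ sumDyck n (λ w → F (w ++ U ∷ D ∷ [])) +ℤ sumDyckDD n F
sumDyck-suc n F = begin
  sumWords (double (suc n)) G
    ≡⟨ cong (λ m → sumWords m G) (ℕ.+-comm 2 (double n)) ⟩
  sumWords (double n + 2) G
    ≡⟨ sumWords-++ (double n) 2 G ⟩
  sumWords (double n) (λ w → sumWords 2 (λ r → G (w ++ r)))
    ≡⟨ sumWords-cong (double n) (λ w _ → lastTwo w) ⟩
  sumWords (double n) (λ w → 𝟙 (isDyck w) *ℤ F (w ++ U ∷ D ∷ []) +ℤ G (w ++ D ∷ D ∷ []))
    ≡⟨ sumWords-+ (double n) _ _ ⟩
  sumDyck n (λ w → F (w ++ U ∷ D ∷ [])) +ℤ sumDyckDD n F ∎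
  where
  G : Path → ℤ
  G w = 𝟙 (isDyck w) *ℤ F w
  dead : ∀ w x → G (w ++ x ∷ U ∷ []) ≡ +0
  dead w x = cong (λ b → 𝟙 b *ℤ F (w ++ x ∷ U ∷ [])) (isDyck-++U w x)
  lastTwo : ∀ w → sumWords 2 (λ r → G (w ++ r)) ≡ 𝟙 (isDyck w) *ℤ F (w ++ U ∷ D ∷ []) +ℤ G (w ++ D ∷ D ∷ [])
  lastTwo w = cong₂ _+ℤ_
    (trans (cong₂ _+ℤ_ (dead w U) (cong (λ b → 𝟙 b *ℤ F (w ++ U ∷ D ∷ [])) (walk-++UD 0 w)))
           (ℤ.+-identityˡ (𝟙 (isDyck w) *ℤ F (w ++ U ∷ D ∷ []))))
    (trans (cong (_+ℤ G (w ++ D ∷ D ∷ [])) (dead w D)) (ℤ.+-identityˡ (G (w ++ D ∷ D ∷ []))))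

count-irreducible-lift : ∀ n i j → count isIrreducible valleys tfalls (suc n) i j ≡ sumDyck n (λ w → stat i j (U ∷ w ++ D ∷ []))
count-irreducible-lift n i j = begin
  sumWords (suc (double n)) (H ∘ (U ∷_)) +ℤ sumWords (suc (double n)) (λ _ → +0)
    ≡⟨ trans (cong (sumWords (suc (double n)) (H ∘ (U ∷_)) +ℤ_) (sumWords-zero (suc (double n)))) (ℤ.+-identityʳ _) ⟩
  sumWords (suc (double n)) (H ∘ (U ∷_))
    ≡⟨ cong (λ m → sumWords m (H ∘ (U ∷_))) (ℕ.+-comm 1 (double n)) ⟩
  sumWords (double n + 1) (H ∘ (U ∷_))
    ≡⟨ sumWords-++ (double n) 1 (H ∘ (U ∷_)) ⟩
  sumWords (double n) (λ w → H (U ∷ w ++ U ∷ []) +ℤ H (U ∷ w ++ D ∷ []))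
    ≡⟨ (sumWords-cong (double n) λ w _ → trans (cong₂ _+ℤ_ (dead w) (lift w)) (ℤ.+-identityˡ _)) ⟩
  sumDyck n (λ w → stat i j (U ∷ w ++ D ∷ [])) ∎
  where
  H : Path → ℤ
  H w = 𝟙 (isIrreducible w) *ℤ stat i j w
  dead : ∀ w → H (U ∷ w ++ U ∷ []) ≡ +0
  dead w = cong (λ b → 𝟙 (b ∧ (rets 1 (w ++ U ∷ []) ≡ᵇ 1)) *ℤ stat i j (U ∷ w ++ U ∷ [])) (walk-++U 1 w)
  lift : ∀ w → H (U ∷ w ++ D ∷ []) ≡ 𝟙 (isDyck w) *ℤ stat i j (U ∷ w ++ D ∷ [])
  lift w = cong (λ b → 𝟙 b *ℤ stat i j (U ∷ w ++ D ∷ [])) (returnsExactly-one-++D 0 w)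

stat-++UD : ∀ i j w → 𝟙 (isDyck w) *ℤ stat i j (w ++ U ∷ D ∷ []) ≡
  𝟙 (isDyck⁺ w) *ℤ 𝟙 ((i ≡ᵇ suc (valleys w)) ∧ (j ≡ᵇ tfalls w)) +ℤ 𝟙 (null w) *ℤ 𝟙 ((i ≡ᵇ 0) ∧ (j ≡ᵇ 0))
stat-++UD i j [] = sym (ℤ.+-identityˡ _)
stat-++UD i j (x ∷ w) with walk 0 (x ∷ w) in dyck
... | false = refl
... | true = trans (cong (+ 1 *ℤ_) (cong₂ (λ p q → 𝟙 ((i ≡ᵇ p) ∧ (j ≡ᵇ q)))
                     (trans (valleys-++U (x ∷ w) (D ∷ []) (walk-endsWithD 0 x w dyck)) (cong suc (ℕ.+-identityʳ _)))
                     (trans (tfalls-++U (x ∷ w) (D ∷ [])) (ℕ.+-identityʳ _))))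
                 (sym (ℤ.+-identityʳ _))

sumWords-null : ∀ k c → sumWords (double k) (λ w → 𝟙 (null w) *ℤ c) ≡ 𝟙 (k ≡ᵇ 0) *ℤ c
sumWords-null zero c = refl
sumWords-null (suc k) c = cong₂ _+ℤ_ (cong₂ _+ℤ_ none none) (cong₂ _+ℤ_ none none)
  where none = sumWords-zero (double k)

sumDyck-++UD : ∀ k i j → sumDyck k (λ w → stat i j (w ++ U ∷ D ∷ [])) ≡ guard≤ 1 i ((A ⊝ one) k (i ∸ 1) j) +ℤ one k i j
sumDyck-++UD k i j = begin
  sumWords (double k) (λ w → 𝟙 (isDyck w) *ℤ stat i j (w ++ U ∷ D ∷ []))
    ≡⟨ (sumWords-cong (double k) λ w _ → stat-++UD i j w) ⟩
  sumWords (double k) (λ w → 𝟙 (isDyck⁺ w) *ℤ 𝟙 ((i ≡ᵇ suc (valleys w)) ∧ (j ≡ᵇ tfalls w)) +ℤ 𝟙 (null w) *ℤ empty)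
    ≡⟨ sumWords-+ (double k) _ _ ⟩
  count isDyck⁺ (suc ∘ valleys) tfalls k i j +ℤ sumWords (double k) (λ w → 𝟙 (null w) *ℤ empty)
    ≡⟨ cong₂ _+ℤ_ (trans (count-sucᵛ isDyck⁺ valleys tfalls k i j) (cong (guard≤ 1 i) (sym (A⊝one k (i ∸ 1) j))))
                  (trans (sumWords-null k empty) (sym (𝟙-∧ (k ≡ᵇ 0) _))) ⟩
  guard≤ 1 i ((A ⊝ one) k (i ∸ 1) j) +ℤ one k i j ∎
  where
  empty = 𝟙 ((i ≡ᵇ 0) ∧ (j ≡ᵇ 0))

A⊝one-suc : ∀ k i j → (A ⊝ one) (suc k) i j ≡ guard≤ 1 i ((A ⊝ one) k (i ∸ 1) j) +ℤ one k i j +ℤ sumDyckDD k (stat i j)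
A⊝one-suc k i j = begin
  A (suc k) i j +ℤ +0
    ≡⟨ trans (ℤ.+-identityʳ _) (gf≡count isDyck (suc k) i j) ⟩
  sumDyck (suc k) (stat i j)
    ≡⟨ sumDyck-suc k (stat i j) ⟩
  sumDyck k (λ w → stat i j (w ++ U ∷ D ∷ [])) +ℤ sumDyckDD k (stat i j)
    ≡⟨ cong (_+ℤ sumDyckDD k (stat i j)) (sumDyck-++UD k i j) ⟩
  guard≤ 1 i ((A ⊝ one) k (i ∸ 1) j) +ℤ one k i j +ℤ sumDyckDD k (stat i j) ∎

𝟙-≡ᵇ-suc : ∀ p j t → 𝟙 (p ∧ (j ≡ᵇ suc t)) ≡ guard≤ 1 j (𝟙 (p ∧ (j ∸ 1 ≡ᵇ t)))
𝟙-≡ᵇ-suc p zero t = cong 𝟙 (∧-zeroʳ p)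
𝟙-≡ᵇ-suc p (suc j) t = refl

B-suc-suc : ∀ k i j → B (suc (suc k)) i j ≡
  guard≤ 1 i ((A ⊝ one) k (i ∸ 1) j) +ℤ one k i j +ℤ guard≤ 1 j (sumDyckDD k (stat i (j ∸ 1)))
B-suc-suc k i j = begin
  B (suc (suc k)) i j
    ≡⟨ trans (sym (ℤ.+-identityʳ _)) (B⊝one (suc (suc k)) i j) ⟩
  count isIrreducible valleys tfalls (suc (suc k)) i j
    ≡⟨ count-irreducible-lift (suc k) i j ⟩
  sumDyck (suc k) (λ w → stat i j (U ∷ w ++ D ∷ []))
    ≡⟨ sumDyck-suc k (λ w → stat i j (U ∷ w ++ D ∷ [])) ⟩
  sumDyck k (λ w → stat i j (U ∷ (w ++ U ∷ D ∷ []) ++ D ∷ []))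
    +ℤ sumDyckDD k (λ w → stat i j (U ∷ w ++ D ∷ []))
    ≡⟨ cong₂ _+ℤ_ (sumWords-cong (double k) λ w _ → cong (𝟙 (isDyck w) *ℤ_) (liftUD w))
         (trans (sumWords-cong (double k) λ w _ → trans (cong (𝟙 (isDyck (w ++ D ∷ D ∷ [])) *ℤ_) (liftDD w))
                                                        (sym (guard≤-*ʳ 1 j (𝟙 (isDyck (w ++ D ∷ D ∷ [])))
                                                                               (stat i (j ∸ 1) (w ++ D ∷ D ∷ [])))))
                (sumWords-guard≤ (double k) 1 j λ w → 𝟙 (isDyck (w ++ D ∷ D ∷ [])) *ℤ stat i (j ∸ 1) (w ++ D ∷ D ∷ []))) ⟩
  sumDyck k (λ w → stat i j (w ++ U ∷ D ∷ [])) +ℤ guard≤ 1 j (sumDyckDD k (stat i (j ∸ 1)))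
    ≡⟨ cong (_+ℤ guard≤ 1 j (sumDyckDD k (stat i (j ∸ 1)))) (sumDyck-++UD k i j) ⟩
  guard≤ 1 i ((A ⊝ one) k (i ∸ 1) j) +ℤ one k i j +ℤ guard≤ 1 j (sumDyckDD k (stat i (j ∸ 1))) ∎
  where
  liftUD : ∀ w → stat i j (U ∷ (w ++ U ∷ D ∷ []) ++ D ∷ []) ≡ stat i j (w ++ U ∷ D ∷ [])
  liftUD w = cong₂ (λ p q → 𝟙 ((i ≡ᵇ p) ∧ (j ≡ᵇ q)))
    (valleys-++D (w ++ U ∷ D ∷ []))
    (trans (cong tfalls (++-assoc w (U ∷ D ∷ []) (D ∷ [])))
           (trans (tfalls-++U w (D ∷ D ∷ [])) (sym (tfalls-++U w (D ∷ [])))))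
  liftDD : ∀ w → stat i j (U ∷ (w ++ D ∷ D ∷ []) ++ D ∷ []) ≡ guard≤ 1 j (stat i (j ∸ 1) (w ++ D ∷ D ∷ []))
  liftDD w = trans (cong₂ (λ p q → 𝟙 ((i ≡ᵇ p) ∧ (j ≡ᵇ q)))
                     (valleys-++D (w ++ D ∷ D ∷ []))
                     (trans (cong tfalls (++-assoc w (D ∷ D ∷ []) (D ∷ []))) (tfalls-++DDD w)))
                   (𝟙-≡ᵇ-suc (i ≡ᵇ valleys (w ++ D ∷ D ∷ [])) j (tfalls (w ++ D ∷ D ∷ [])))

A-via-B : A ≐ B ⊕ Y ⊛ (B ⊝ one) ⊛ (A ⊝ one)
A-via-B n i j = begin
  A n i j
    ≡⟨ sym (undo (A n i j) (one n i j)) ⟩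
  (A ⊝ one) n i j +ℤ one n i j
    ≡⟨ cong (_+ℤ one n i j) (trans (A⊝one n i j) (count-firstReturn n i j)) ⟩
  count isIrreducible valleys tfalls n i j
    +ℤ (count isIrreducible (suc ∘ valleys) tfalls ⊛ count isDyck⁺ valleys tfalls) n i j +ℤ one n i j
    ≡⟨ cong₂ (λ p q → p +ℤ q +ℤ one n i j) (sym (B⊝one n i j))
         (sym (⊛-cong Y⊛B⊝one A⊝one n i j)) ⟩
  (B ⊝ one) n i j +ℤ (Y ⊛ (B ⊝ one) ⊛ (A ⊝ one)) n i j +ℤ one n i j
    ≡⟨ shuffle (B n i j) (one n i j) ((Y ⊛ (B ⊝ one) ⊛ (A ⊝ one)) n i j) ⟩
  B n i j +ℤ (Y ⊛ (B ⊝ one) ⊛ (A ⊝ one)) n i j ∎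
  where
  Y⊛B⊝one : Y ⊛ (B ⊝ one) ≐ count isIrreducible (suc ∘ valleys) tfalls
  Y⊛B⊝one = ⊛-cong (≐-refl {Y}) B⊝one ≐-trans Y⊛count isIrreducible valleys tfalls
  undo : ∀ a o → a +ℤ -ℤ o +ℤ o ≡ a
  undo = solve-∀
  shuffle : ∀ b o s → b +ℤ -ℤ o +ℤ s +ℤ o ≡ b +ℤ s
  shuffle = solve-∀

B-rhs-expand : ∀ n i j →
  ((A ⊝ one) ⊛ (X ⊛ Z ⊕ X ⊛ X ⊛ Y ⊝ X ⊛ X ⊛ Y ⊛ Z) ⊕ one ⊕ X ⊕ X ⊛ X ⊝ X ⊛ X ⊛ Z) n i j ≡
  shift 1 0 1 (A ⊝ one) n i j +ℤ shift 2 1 0 (A ⊝ one) n i j +ℤ -ℤ shift 2 1 1 (A ⊝ one) n i j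
    +ℤ one n i j +ℤ X n i j +ℤ mono 2 0 0 n i j +ℤ -ℤ shift 0 0 1 (mono 2 0 0) n i j
B-rhs-expand n i j =
  cong₂ _+ℤ_ (cong₂ _+ℤ_ (cong (λ s → s +ℤ one n i j +ℤ X n i j) product) (XX n i j)) (cong -ℤ_ XXZ)
  where
  f = A ⊝ one
  XX : X ⊛ X ≐ mono 2 0 0
  XX = mono-⊛-mono 1 0 0 1 0 0
  XXY : X ⊛ X ⊛ Y ≐ mono 2 1 0
  XXY = ⊛-cong XX (≐-refl {Y}) ≐-trans mono-⊛-mono 2 0 0 0 1 0
  XXYZ : X ⊛ X ⊛ Y ⊛ Z ≐ mono 2 1 1
  XXYZ = ⊛-cong XXY (≐-refl {Z}) ≐-trans mono-⊛-mono 2 1 0 0 0 1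
  XXZ : (X ⊛ X ⊛ Z) n i j ≡ shift 0 0 1 (mono 2 0 0) n i j
  XXZ = (⊛-cong XX (≐-refl {Z}) ≐-trans ⊛-mono 0 0 1 (mono 2 0 0)) n i j
  product : (f ⊛ (X ⊛ Z ⊕ X ⊛ X ⊛ Y ⊝ X ⊛ X ⊛ Y ⊛ Z)) n i j ≡
            shift 1 0 1 f n i j +ℤ shift 2 1 0 f n i j +ℤ -ℤ shift 2 1 1 f n i j
  product = begin
    (f ⊛ (X ⊛ Z ⊕ X ⊛ X ⊛ Y ⊝ X ⊛ X ⊛ Y ⊛ Z)) n i j
      ≡⟨ ⊛-cong (≐-refl {f}) (⊕-cong (⊕-cong (mono-⊛-mono 1 0 0 0 0 1) XXY) (⊖-cong XXYZ)) n i j ⟩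
    (f ⊛ (mono 1 0 1 ⊕ mono 2 1 0 ⊝ mono 2 1 1)) n i j
      ≡⟨ ⊛-distribˡ-⊕ f (mono 1 0 1 ⊕ mono 2 1 0) (⊖ mono 2 1 1) n i j ⟩
    (f ⊛ (mono 1 0 1 ⊕ mono 2 1 0)) n i j +ℤ (f ⊛ (⊖ mono 2 1 1)) n i j
      ≡⟨ cong₂ _+ℤ_ (⊛-distribˡ-⊕ f (mono 1 0 1) (mono 2 1 0) n i j) (⊛-distribˡ-⊖ f (mono 2 1 1) n i j) ⟩
    (f ⊛ mono 1 0 1) n i j +ℤ (f ⊛ mono 2 1 0) n i j +ℤ -ℤ (f ⊛ mono 2 1 1) n i j
      ≡⟨ cong₂ _+ℤ_ (cong₂ _+ℤ_ (⊛-mono 1 0 1 f n i j) (⊛-mono 2 1 0 f n i j)) (cong -ℤ_ (⊛-mono 2 1 1 f n i j)) ⟩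
    shift 1 0 1 f n i j +ℤ shift 2 1 0 f n i j +ℤ -ℤ shift 2 1 1 f n i j ∎

B-via-A : B ≐ (A ⊝ one) ⊛ (X ⊛ Z ⊕ X ⊛ X ⊛ Y ⊝ X ⊛ X ⊛ Y ⊛ Z) ⊕ one ⊕ X ⊕ X ⊛ X ⊝ X ⊛ X ⊛ Z
B-via-A 0 0 0 = sym (B-rhs-expand 0 0 0)
B-via-A 0 0 (suc j) = sym (B-rhs-expand 0 0 (suc j))
B-via-A 0 (suc i) 0 = sym (B-rhs-expand 0 (suc i) 0)
B-via-A 0 (suc i) (suc j) = sym (B-rhs-expand 0 (suc i) (suc j))
B-via-A 1 0 0 = sym (B-rhs-expand 1 0 0)
B-via-A 1 0 1 = sym (B-rhs-expand 1 0 1)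
B-via-A 1 0 (suc (suc j)) = sym (B-rhs-expand 1 0 (suc (suc j)))
B-via-A 1 (suc i) 0 = sym (B-rhs-expand 1 (suc i) 0)
B-via-A 1 (suc i) (suc j) = sym (B-rhs-expand 1 (suc i) (suc j))
B-via-A (suc (suc k)) i j = begin
  B (suc (suc k)) i j
    ≡⟨ B-suc-suc k i j ⟩
  s j +ℤ one k i j +ℤ guard≤ 1 j (dd (j ∸ 1))
    ≡⟨ sym (cancel (s j) (one k i j) (guard≤ 1 j (dd (j ∸ 1))) (guard≤ 1 j (s (j ∸ 1))) (guard≤ 1 j (one k i (j ∸ 1)))) ⟩
  guard≤ 1 j (s (j ∸ 1)) +ℤ guard≤ 1 j (one k i (j ∸ 1)) +ℤ guard≤ 1 j (dd (j ∸ 1)) +ℤ s j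
    +ℤ -ℤ guard≤ 1 j (s (j ∸ 1)) +ℤ +0 +ℤ +0 +ℤ one k i j +ℤ -ℤ guard≤ 1 j (one k i (j ∸ 1))
    ≡⟨ cong₂ (λ p q → p +ℤ s j +ℤ -ℤ q +ℤ +0 +ℤ +0 +ℤ one k i j +ℤ -ℤ guard≤ 1 j (one k i (j ∸ 1)))
         (sym (trans (cong (guard≤ 1 j) (A⊝one-suc k i (j ∸ 1)))
                     (trans (guard≤-+ 1 j _ (dd (j ∸ 1))) (cong (_+ℤ guard≤ 1 j (dd (j ∸ 1))) (guard≤-+ 1 j _ _)))))
         (sym (guard≤-comm 1 i 1 j _)) ⟩
  guard≤ 1 j ((A ⊝ one) (suc k) i (j ∸ 1)) +ℤ s j +ℤ -ℤ guard≤ 1 i (guard≤ 1 j ((A ⊝ one) k (i ∸ 1) (j ∸ 1)))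
    +ℤ +0 +ℤ +0 +ℤ one k i j +ℤ -ℤ guard≤ 1 j (one k i (j ∸ 1))
    ≡⟨ sym (B-rhs-expand (suc (suc k)) i j) ⟩
  ((A ⊝ one) ⊛ (X ⊛ Z ⊕ X ⊛ X ⊛ Y ⊝ X ⊛ X ⊛ Y ⊛ Z) ⊕ one ⊕ X ⊕ X ⊛ X ⊝ X ⊛ X ⊛ Z) (suc (suc k)) i j ∎
  where
  s dd : ℕ → ℤ
  s j' = guard≤ 1 i ((A ⊝ one) k (i ∸ 1) j')
  dd j' = sumDyckDD k (stat i j')
  cancel : ∀ s o e s' o' → s' +ℤ o' +ℤ e +ℤ s +ℤ -ℤ s' +ℤ +0 +ℤ +0 +ℤ o +ℤ -ℤ o' ≡ s +ℤ o +ℤ e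
  cancel = solve-∀

proposition4 : (B ≐ (A ⊝ one) ⊛ (X ⊛ Z ⊕ X ⊛ X ⊛ Y ⊝ X ⊛ X ⊛ Y ⊛ Z) ⊕ one ⊕ X ⊕ X ⊛ X ⊝ X ⊛ X ⊛ Z)
    × (A ≐ B ⊕ Y ⊛ (B ⊝ one) ⊛ (A ⊝ one))
proposition4 = B-via-A , A-via-B
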